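{- Let $\tau$ be a semistandard reverse composition tableau of straight shape $\alpha$ and let $i\ge0$ be such that $\widetilde\alpha$ has an addable node in column $i+1$. Let $\Phi_1(\tau)=\tau$ and, for $i\ge1$, $\Phi_{i+1}(\tau)=\phi_2(\phi_3(\cdots\phi_{i+1}(\tau)\cdots))$ (apply $\phi_{i+1}$ first). Then the shape of $\Phi_{i+1}(\tau)$ is $\mathfrak{v}_{[i]}(\alpha)$.
   Context: A composition $\alpha=(\alpha_1,\dots,\alpha_l)$ is a sequence of positive integers; $\widetilde\alpha$ is its decreasing rearrangement, a partition (French convention, columns numbered left to right); an addable node is a box outside a partition whose addition gives a partition. Reverse composition diagram: row $r$ (numbered top to bottom) has $\alpha_r$ left-justified boxes. An SSRCT of straight shape $\alpha$ is a filling $\tau$ by positive integers with rows weakly decreasing left to right, first column strictly increasing top to bottom, and: for $i<j$, if $(j,k+1)$ is a box and $(i,k)$ is a box with $\tau(i,k)\ge\tau(j,k+1)$, then $(i,k+1)$ is a box and $\tau(i,k+1)>\tau(j,k+1)$. For $m\ge1$ and an SSRCT $\sigma$ of shape $\beta$ with $\widetilde\beta$ having an addable node in column $m+1$ (write $\sigma(r,c)=0$ outside $\beta$): let $r_1$ be the largest index with $\beta_{r_1}=m$; for $j\ge2$, $r_j$ is the largest $r<r_{j-1}$ with $\sigma(r,m)>\sigma(r_{j-1},m)\ge\sigma(r,m+1)$, while it exists; $r_k$ the last. $\phi_{m+1}(\sigma)$: for $j=k,\dots,2$ place $\sigma(r_{j-1},m)$ into $(r_j,m)$, discard the original $\sigma(r_k,m)$,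 delete box $(r_1,m)$ (and the row if it becomes empty). (In the composite defining $\Phi_{i+1}$ each $\phi$ is defined.) Operators: $\mathfrak{d}_m(\beta)$ subtracts $1$ from the rightmost part equal to $m$ (deleting a resulting $0$; it is $0$ if no such part); $\mathfrak{v}_{[i]}=\mathfrak{d}_1\mathfrak{d}_2\cdots\mathfrak{d}_i$, applying $\mathfrak{d}_i$ first and $\mathfrak{d}_1$ last; $\mathfrak{v}_{[0]}$ is the identity. -}

module Defs where

open import Data.Nat using (ℕ; zero; suc; _≤_; _<_; _∸_; _+_; _≡ᵇ_; _≤ᵇ_; _<ᵇ_; _≟_; _≤?_; _<?_)
open import Data.List using (List; []; _∷_; length; map; filter; reverse; take; foldr)
open import Data.Maybe using (Maybe; just; nothing; _>>=_)
import Data.Maybe as Maybe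
open import Data.Bool using (Bool; true; false; if_then_else_; _∧_)
open import Data.Product using (_×_; _,_)
open import Data.Sum using (_⊎_)
open import Relation.Nullary using (Dec; yes; no)
open import Relation.Nullary.Decidable using (_⊎-dec_; _×-dec_)
open import Relation.Binary.PropositionalEquality using (_≡_)

-- A composition is a list of positive naturals.
-- A filling of a reverse composition diagram is a list of rows, listed
-- top to bottom; each row lists its entries left to right.
-- Rows and columns are numbered from 1.

Composition : Set
Composition = List ℕ

Tableau : Set
Tableau = List (List ℕ)

nth : {A : Set} → A → List A → ℕ → A
nth d [] _ = d
nth d (x ∷ xs) zero = x
nth d (x ∷ xs) (suc n) = nth d xs n

modifyNth : {A : Set} → (A → A) → ℕ → List A → List A
modifyNth f _ [] = []
modifyNth f zero (x ∷ xs) = f x ∷ xs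
modifyNth f (suc n) (x ∷ xs) = x ∷ modifyNth f n xs

deleteNth : {A : Set} → ℕ → List A → List A
deleteNth _ [] = []
deleteNth zero (x ∷ xs) = xs
deleteNth (suc n) (x ∷ xs) = x ∷ deleteNth n xs

row : Tableau → ℕ → List ℕ
row τ zero = []
row τ (suc r) = nth [] τ r

rowLen : Tableau → ℕ → ℕ
rowLen τ r = length (row τ r)

-- τ(r,c), 1-indexed, 0 outside the diagram
entry : Tableau → ℕ → ℕ → ℕ
entry τ r zero = 0
entry τ r (suc c) = nth 0 (row τ r) c

Box : Tableau → ℕ → ℕ → Set
Box τ r c = (1 ≤ r) × (1 ≤ c) × (c ≤ rowLen τ r)

shape : Tableau → Composition
shape τ = map length τ

record SSRCT (τ : Tableau) : Set where
  field
    rowsNonempty : ∀ r → 1 ≤ r → r ≤ length τ → 1 ≤ rowLen τ r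
    positive     : ∀ r c → Box τ r c → 1 ≤ entry τ r c
    rowsWeaklyDecr : ∀ r c → Box τ r (suc c) → 1 ≤ c → entry τ r (suc c) ≤ entry τ r c
    firstColIncr : ∀ r → 1 ≤ r → Box τ (suc r) 1 → entry τ r 1 < entry τ (suc r) 1
    triple : ∀ i j k → i < j → 1 ≤ k → Box τ j (suc k) → Box τ i k →
             entry τ j (suc k) ≤ entry τ i k →
             Box τ i (suc k) × (entry τ j (suc k) < entry τ i (suc k))

insertDesc : ℕ → List ℕ → List ℕ
insertDesc x [] = x ∷ []
insertDesc x (y ∷ ys) = if y ≤ᵇ x then x ∷ y ∷ ys else y ∷ insertDesc x ys

rearrange : Composition → List ℕ
rearrange = foldr insertDesc []

colLen : List ℕ → ℕ → ℕ
colLen λ' c = length (filter (c ≤?_) λ')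

-- λ has an addable node in column c: for c = 1 always; for c ≥ 2 the
-- box on top of column c can be added iff column c is strictly shorter
-- than column c-1.
AddableInCol : List ℕ → ℕ → Set
AddableInCol λ' c = (c ≡ 1) ⊎ ((2 ≤ c) × (colLen λ' c < colLen λ' (c ∸ 1)))

addableInCol? : ∀ λ' c → Dec (AddableInCol λ' c)
addableInCol? λ' c = (c ≟ 1) ⊎-dec ((2 ≤? c) ×-dec (colLen λ' c <? colLen λ' (c ∸ 1)))

largestBelow : (ℕ → Bool) → ℕ → Maybe ℕ
largestBelow p zero = nothing
largestBelow p (suc zero) = nothing
largestBelow p (suc (suc n)) = if p (suc n) then just (suc n) else largestBelow p (suc n)

-- the sequence r_1 > r_2 > ... > r_k (fuel bounds the length)
chain : Tableau → ℕ → ℕ → ℕ → List ℕ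
chain σ m zero r = r ∷ []
chain σ m (suc f) r with largestBelow
    (λ r' → (entry σ r m <ᵇ entry σ r' m) ∧ (entry σ r' (suc m) ≤ᵇ entry σ r m)) r
... | nothing = r ∷ []
... | just r' = r ∷ chain σ m f r'

moves : Tableau → ℕ → List ℕ → List (ℕ × ℕ)
moves σ m (a ∷ b ∷ rest) = (b , entry σ a m) ∷ moves σ m (b ∷ rest)
moves σ m _ = []

setEntry : ℕ → ℕ → ℕ → Tableau → Tableau
setEntry r c v τ = modifyNth (modifyNth (λ _ → v) (c ∸ 1)) (r ∸ 1) τ

applyMoves : ℕ → List (ℕ × ℕ) → Tableau → Tableau
applyMoves m [] τ = τ
applyMoves m ((r , v) ∷ ms) τ = applyMoves m ms (setEntry r m v τ)

-- delete box (r,m), the last box of row r (of length m), and the row if empty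
deleteBox : ℕ → ℕ → Tableau → Tableau
deleteBox r m τ with m ≟ 1
... | yes _ = deleteNth (r ∸ 1) τ
... | no _  = modifyNth (take (m ∸ 1)) (r ∸ 1) τ

-- phi m σ is φ_{m+1}(σ) (m ≥ 1); nothing when undefined
phi : ℕ → Tableau → Maybe Tableau
phi m σ with addableInCol? (rearrange (shape σ)) (suc m)
... | no _ = nothing
... | yes _ with largestBelow (λ r → rowLen σ r ≡ᵇ m) (suc (length σ))
...   | nothing = nothing
...   | just r₁ = just (deleteBox r₁ m (applyMoves m (moves σ m (chain σ m r₁ r₁)) σ))

-- Phi i τ is Φ_{i+1}(τ) = φ_2(φ_3(⋯φ_{i+1}(τ)⋯)),  Φ_1 = id
Phi : ℕ → Tableau → Maybe Tableau
Phi zero τ = just τ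
Phi (suc i) τ = phi (suc i) τ >>= Phi i

decFirst : ℕ → List ℕ → Maybe (List ℕ)
decFirst m [] = nothing
decFirst m (x ∷ xs) = if x ≡ᵇ m
  then just (if x ≡ᵇ 1 then xs else (x ∸ 1) ∷ xs)
  else Maybe.map (x ∷_) (decFirst m xs)

-- 𝔡_m : rightmost part equal to m; nothing represents 0
dOp : ℕ → Composition → Maybe Composition
dOp m α = Maybe.map reverse (decFirst m (reverse α))

-- 𝔳_[i] = 𝔡_1 ⋯ 𝔡_i  (𝔡_i applied first)
vOp : ℕ → Composition → Maybe Composition
vOp zero α = just α
vOp (suc i) α = dOp (suc i) α >>= vOp i

-- Only shapes matter. φ_{m+1} moves entries around inside the diagram and then deletes the last
-- box of the lowest row of length m, so on shapes it acts as 𝔡_m; such a row exists because an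
-- addable node in column m + 1 of α̃ means that column m is strictly longer than column m + 1,
-- i.e. some part equals m. Lowering that part removes one box from column m and leaves every other
-- column unchanged, so column m is now shorter than column m − 1: the new shape has an addable node
-- in column m and the induction continues down to Φ_1 = id.
module Submission where

open import Defs
open import Data.Nat using (ℕ; zero; suc; _≤_; _<_; _+_; _∸_; _⊓_; _≡ᵇ_; _≤ᵇ_; _≟_; _≤?_; z≤n; s≤s)
open import Data.Nat.Properties
  using (≡ᵇ⇒≡; ≡⇒≡ᵇ; ≤-refl; <⇒≤; ≤∧≢⇒<; ≤-pred; m≤n⇒m≤1+n; m<n⇒m<1+n; m≤n⇒m<n∨m≡n;
         n≤1+n; 1+n≰n; 1+n≢n; n≮n; m≤n⇒m⊓n≡m; +-suc; module ≤-Reasoning)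
open import Data.Bool using (Bool; true; false; if_then_else_)
open import Data.Bool.Properties using (T-≡; ¬-not)
open import Data.List using (List; []; _∷_; _++_; length; map; filter; reverse; take)
open import Data.List.Properties
  using (filter-accept; filter-reject; filter-++; length-++; length-map; length-take;
         reverse-++; reverse-involutive; ++-assoc)
open import Data.List.Membership.Propositional using (_∈_; _∉_)
open import Data.List.Membership.DecPropositional _≟_ using (_∈?_)
open import Data.List.Relation.Unary.Any using (here; there)
open import Data.List.Relation.Unary.Any.Properties using (reverse⁻)
open import Data.List.Relation.Binary.Permutation.Propositional
  using (_↭_; prep; swap; ↭-refl; ↭-trans)
open import Data.List.Relation.Binary.Permutation.Propositional.Properties using (filter-↭; ↭-length)
open import Data.Maybe using (Maybe; just; _>>=_)
import Data.Maybe as Maybe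
open import Data.Product using (Σ; ∃₂; _×_; _,_)
open import Data.Sum using (inj₁; inj₂)
open import Function using (_∘_)
open import Function.Bundles using (Equivalence)
open import Relation.Nullary using (yes; no; ¬_; contradiction)
open import Relation.Binary.PropositionalEquality
  using (_≡_; _≢_; refl; sym; trans; cong; cong₂; subst; subst₂; module ≡-Reasoning)

≡ᵇ-refl : ∀ m → (m ≡ᵇ m) ≡ true
≡ᵇ-refl m = Equivalence.to T-≡ (≡⇒≡ᵇ m m refl)

≢⇒≡ᵇ-false : ∀ {x m} → x ≢ m → (x ≡ᵇ m) ≡ false
≢⇒≡ᵇ-false {x} {m} x≢m = ¬-not (x≢m ∘ ≡ᵇ⇒≡ x m ∘ Equivalence.from T-≡)

reverse-++₃ : ∀ {A : Set} (xs ys zs : List A) →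
  reverse (xs ++ ys ++ zs) ≡ reverse zs ++ reverse ys ++ reverse xs
reverse-++₃ xs ys zs = begin
  reverse (xs ++ ys ++ zs)                 ≡⟨ reverse-++ xs (ys ++ zs) ⟩
  reverse (ys ++ zs) ++ reverse xs         ≡⟨ cong (_++ reverse xs) (reverse-++ ys zs) ⟩
  (reverse zs ++ reverse ys) ++ reverse xs ≡⟨ ++-assoc (reverse zs) (reverse ys) (reverse xs) ⟩
  reverse zs ++ reverse ys ++ reverse xs   ∎
  where open ≡-Reasoning

length-middle : ∀ {A : Set} (ys : List A) x zs → length ys < length (ys ++ x ∷ zs)
length-middle [] x zs = s≤s z≤n
length-middle (y ∷ ys) x zs = s≤s (length-middle ys x zs)

nth-∈ : ∀ {A : Set} (d : A) xs k → k < length xs → nth d xs k ∈ xs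
nth-∈ d (x ∷ xs) zero _ = here refl
nth-∈ d (x ∷ xs) (suc k) (s≤s k<n) = there (nth-∈ d xs k k<n)

nth-middle : ∀ {A : Set} (d : A) ys x zs → nth d (ys ++ x ∷ zs) (length ys) ≡ x
nth-middle d [] x zs = refl
nth-middle d (y ∷ ys) x zs = nth-middle d ys x zs

nth-after-middle : ∀ {A : Set} (d : A) ys x zs k →
  length ys < k → k < length (ys ++ x ∷ zs) → nth d (ys ++ x ∷ zs) k ∈ zs
nth-after-middle d [] x zs (suc k) _ (s≤s k<n) = nth-∈ d zs k k<n
nth-after-middle d (y ∷ ys) x zs (suc k) (s≤s ys<k) (s≤s k<n) = nth-after-middle d ys x zs k ys<k k<n

deleteNth-middle : ∀ {A : Set} (ys : List A) x zs → deleteNth (length ys) (ys ++ x ∷ zs) ≡ ys ++ zs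
deleteNth-middle [] x zs = refl
deleteNth-middle (y ∷ ys) x zs = cong (y ∷_) (deleteNth-middle ys x zs)

modifyNth-middle : ∀ {A : Set} (f : A → A) ys x zs →
  modifyNth f (length ys) (ys ++ x ∷ zs) ≡ ys ++ f x ∷ zs
modifyNth-middle f [] x zs = refl
modifyNth-middle f (y ∷ ys) x zs = cong (y ∷_) (modifyNth-middle f ys x zs)

modifyNth-id : ∀ {A : Set} n (xs : List A) → modifyNth (λ x → x) n xs ≡ xs
modifyNth-id n [] = refl
modifyNth-id zero (x ∷ xs) = refl
modifyNth-id (suc n) (x ∷ xs) = cong (x ∷_) (modifyNth-id n xs)

length-modifyNth : ∀ {A : Set} (f : A → A) n xs → length (modifyNth f n xs) ≡ length xs
length-modifyNth f n [] = refl
length-modifyNth f zero (x ∷ xs) = refl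
length-modifyNth f (suc n) (x ∷ xs) = cong suc (length-modifyNth f n xs)

map-deleteNth : ∀ {A B : Set} (f : A → B) n xs → map f (deleteNth n xs) ≡ deleteNth n (map f xs)
map-deleteNth f n [] = refl
map-deleteNth f zero (x ∷ xs) = refl
map-deleteNth f (suc n) (x ∷ xs) = cong (f x ∷_) (map-deleteNth f n xs)

map-modifyNth : ∀ {A B : Set} (f : A → B) {g : A → A} {h : B → B} → (∀ x → f (g x) ≡ h (f x)) →
  ∀ n xs → map f (modifyNth g n xs) ≡ modifyNth h n (map f xs)
map-modifyNth f fg≗hf n [] = refl
map-modifyNth f fg≗hf zero (x ∷ xs) = cong (_∷ map f xs) (fg≗hf x)
map-modifyNth f fg≗hf (suc n) (x ∷ xs) = cong (f x ∷_) (map-modifyNth f fg≗hf n xs)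

lastSplit : ∀ {m} α → m ∈ α → ∃₂ λ ys zs → α ≡ ys ++ m ∷ zs × m ∉ zs
lastSplit {m} (x ∷ xs) m∈ with m ∈? xs
... | yes m∈xs with ys , zs , split , m∉zs ← lastSplit xs m∈xs = x ∷ ys , zs , cong (x ∷_) split , m∉zs
... | no m∉xs with m∈
...   | here refl = [] , xs , refl , m∉xs
...   | there m∈xs = contradiction m∈xs m∉xs

largestBelow-unfolded : (ℕ → Bool) → ℕ → Bool → Maybe ℕ
largestBelow-unfolded p n b = if b then just (suc n) else largestBelow p (suc n)

largestBelow-hit : ∀ {p : ℕ → Bool} {k} n → p k ≡ true → (∀ r → k < r → r < suc n → p r ≡ false) →
  1 ≤ k → k ≤ n → largestBelow p (suc n) ≡ just k
largestBelow-hit zero _ _ (s≤s z≤n) ()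
largestBelow-hit {p} {k} (suc n) pk misses 1≤k k≤1+n with m≤n⇒m<n∨m≡n k≤1+n
... | inj₂ k≡1+n =
  trans (cong (largestBelow-unfolded p n) (subst (λ r → p r ≡ true) k≡1+n pk)) (cong just (sym k≡1+n))
... | inj₁ k<1+n = trans (cong (largestBelow-unfolded p n) (misses (suc n) k<1+n ≤-refl))
  (largestBelow-hit n pk (λ r k<r r<1+n → misses r k<r (m<n⇒m<1+n r<1+n)) 1≤k (≤-pred k<1+n))

colLen-accept : ∀ {c x} xs → c ≤ x → colLen (x ∷ xs) c ≡ suc (colLen xs c)
colLen-accept {c} xs c≤x = cong length (filter-accept (c ≤?_) {xs = xs} c≤x)

colLen-reject : ∀ {c x} xs → ¬ c ≤ x → colLen (x ∷ xs) c ≡ colLen xs c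
colLen-reject {c} xs c≰x = cong length (filter-reject (c ≤?_) {xs = xs} c≰x)

colLen-++ : ∀ c xs ys → colLen (xs ++ ys) c ≡ colLen xs c + colLen ys c
colLen-++ c xs ys = trans (cong length (filter-++ (c ≤?_) xs ys)) (length-++ (filter (c ≤?_) xs))

colLen-middle : ∀ c ys xs zs → colLen (ys ++ xs ++ zs) c ≡ colLen ys c + (colLen xs c + colLen zs c)
colLen-middle c ys xs zs = trans (colLen-++ c ys (xs ++ zs)) (cong (colLen ys c +_) (colLen-++ c xs zs))

colLen-↭ : ∀ c {xs ys} → xs ↭ ys → colLen xs c ≡ colLen ys c
colLen-↭ c xs↭ys = ↭-length (filter-↭ (c ≤?_) xs↭ys)

insertDesc-↭ : ∀ x ys → insertDesc x ys ↭ x ∷ ys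
insertDesc-↭ x [] = ↭-refl
insertDesc-↭ x (y ∷ ys) with y ≤ᵇ x
... | true = ↭-refl
... | false = ↭-trans (prep y (insertDesc-↭ x ys)) (swap y x ↭-refl)

rearrange-↭ : ∀ xs → rearrange xs ↭ xs
rearrange-↭ [] = ↭-refl
rearrange-↭ (x ∷ xs) = ↭-trans (insertDesc-↭ x (rearrange xs)) (prep x (rearrange-↭ xs))

colLen-rearrange : ∀ c xs → colLen (rearrange xs) c ≡ colLen xs c
colLen-rearrange c xs = colLen-↭ c (rearrange-↭ xs)

colLen-antitone : ∀ c xs → colLen xs (suc c) ≤ colLen xs c
colLen-antitone c [] = z≤n
colLen-antitone c (x ∷ xs) with c ≤? x
... | no c≰x rewrite colLen-reject xs c≰x | colLen-reject xs (c≰x ∘ <⇒≤) = colLen-antitone c xs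
... | yes c≤x rewrite colLen-accept xs c≤x with suc c ≤? x
...   | yes c<x rewrite colLen-accept xs c<x = s≤s (colLen-antitone c xs)
...   | no c≮x rewrite colLen-reject xs c≮x = m≤n⇒m≤1+n (colLen-antitone c xs)

colLen-suc-∉ : ∀ {m} xs → m ∉ xs → colLen xs (suc m) ≡ colLen xs m
colLen-suc-∉ [] _ = refl
colLen-suc-∉ {m} (x ∷ xs) m∉ with m ≤? x
... | yes m≤x rewrite colLen-accept xs m≤x | colLen-accept xs (≤∧≢⇒< m≤x (m∉ ∘ here)) =
  cong suc (colLen-suc-∉ xs (m∉ ∘ there))
... | no m≰x rewrite colLen-reject xs m≰x | colLen-reject xs (m≰x ∘ <⇒≤) =
  colLen-suc-∉ xs (m∉ ∘ there)

addable⇒∈ : ∀ {j} α → AddableInCol (rearrange α) (suc (suc j)) → suc j ∈ α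
addable⇒∈ α (inj₁ ())
addable⇒∈ {j} α (inj₂ (_ , column<)) with suc j ∈? α
... | yes m∈α = m∈α
... | no m∉α = contradiction column′< (n≮n _)
  where
  column′< : colLen α (suc j) < colLen α (suc j)
  column′< = subst₂ _<_ (trans (colLen-rearrange _ α) (colLen-suc-∉ α m∉α)) (colLen-rearrange _ α) column<

-- 𝔡_m replaces the rightmost part m of a composition by the list lowered m.
lowered : ℕ → List ℕ
lowered m = if m ≡ᵇ 1 then [] else (m ∸ 1) ∷ []

reverse-lowered : ∀ m → reverse (lowered m) ≡ lowered m
reverse-lowered m with m ≡ᵇ 1
... | true = refl
... | false = refl

colLen-lowered-part : ∀ {c} m → 1 ≤ c → c ≢ m → colLen (lowered m) c ≡ colLen (m ∷ []) c
colLen-lowered-part zero _ _ = refl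
colLen-lowered-part {c} (suc zero) (s≤s z≤n) c≢1 = sym (colLen-reject {c} {1} [] λ { (s≤s z≤n) → c≢1 refl })
colLen-lowered-part {c} (suc (suc k)) _ c≢m with c ≤? suc k
... | yes c≤k+1 = trans (colLen-accept [] c≤k+1) (sym (colLen-accept [] (m≤n⇒m≤1+n c≤k+1)))
... | no c≰k+1 =
  trans (colLen-reject [] c≰k+1) (sym (colLen-reject [] (c≰k+1 ∘ ≤-pred ∘ λ c≤m → ≤∧≢⇒< c≤m c≢m)))

colLen-lowered-self : ∀ k → colLen (lowered (suc k)) (suc k) ≡ 0
colLen-lowered-self zero = refl
colLen-lowered-self (suc k) = colLen-reject {suc (suc k)} {suc k} [] 1+n≰n

colLen-lowered-≢ : ∀ {c m} ys zs → 1 ≤ c → c ≢ m →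
  colLen (ys ++ lowered m ++ zs) c ≡ colLen (ys ++ m ∷ zs) c
colLen-lowered-≢ {c} {m} ys zs 1≤c c≢m = begin
  colLen (ys ++ lowered m ++ zs) c                   ≡⟨ colLen-middle c ys (lowered m) zs ⟩
  colLen ys c + (colLen (lowered m) c + colLen zs c) ≡⟨ cong (λ n → colLen ys c + (n + colLen zs c))
                                                              (colLen-lowered-part m 1≤c c≢m) ⟩
  colLen ys c + (colLen (m ∷ []) c + colLen zs c)    ≡⟨ colLen-middle c ys (m ∷ []) zs ⟨
  colLen (ys ++ m ∷ zs) c                            ∎
  where open ≡-Reasoning

colLen-lowered-≡ : ∀ k ys zs →
  colLen (ys ++ suc k ∷ zs) (suc k) ≡ suc (colLen (ys ++ lowered (suc k) ++ zs) (suc k))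
colLen-lowered-≡ k ys zs = begin
  colLen (ys ++ m ∷ zs) m                                  ≡⟨ colLen-middle m ys (m ∷ []) zs ⟩
  colLen ys m + (colLen (m ∷ []) m + colLen zs m)          ≡⟨ cong (λ n → colLen ys m + (n + colLen zs m))
                                                                    (colLen-accept {m} {m} [] ≤-refl) ⟩
  colLen ys m + suc (colLen zs m)                          ≡⟨ +-suc (colLen ys m) (colLen zs m) ⟩
  suc (colLen ys m + colLen zs m)                          ≡⟨ cong (λ n → suc (colLen ys m + (n + colLen zs m)))
                                                                    (colLen-lowered-self k) ⟨
  suc (colLen ys m + (colLen (lowered m) m + colLen zs m)) ≡⟨ cong suc (colLen-middle m ys (lowered m) zs) ⟨
  suc (colLen (ys ++ lowered m ++ zs) m)                   ∎
  where
  m = suc k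
  open ≡-Reasoning

lowered-addable : ∀ {j} ys zs → AddableInCol (rearrange (ys ++ lowered (suc j) ++ zs)) (suc j)
lowered-addable {zero} _ _ = inj₁ refl
lowered-addable {suc k} ys zs = inj₂ (s≤s (s≤s z≤n) , column<)
  where
  m = suc k
  α = ys ++ suc m ∷ zs
  α′ = ys ++ lowered (suc m) ++ zs
  open ≤-Reasoning
  column< : colLen (rearrange α′) (suc m) < colLen (rearrange α′) m
  column< = begin
    suc (colLen (rearrange α′) (suc m)) ≡⟨ cong suc (colLen-rearrange (suc m) α′) ⟩
    suc (colLen α′ (suc m))             ≡⟨ colLen-lowered-≡ m ys zs ⟨
    colLen α (suc m)                    ≤⟨ colLen-antitone m α ⟩
    colLen α m                          ≡⟨ colLen-lowered-≢ ys zs (s≤s z≤n) (1+n≢n ∘ sym) ⟨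
    colLen α′ m                         ≡⟨ colLen-rearrange m α′ ⟨
    colLen (rearrange α′) m             ∎

decFirst-split : ∀ {m} xs ws → m ∉ xs → decFirst m (xs ++ m ∷ ws) ≡ just (xs ++ lowered m ++ ws)
decFirst-split {m} [] ws _ rewrite ≡ᵇ-refl m with m ≡ᵇ 1
... | true = refl
... | false = refl
decFirst-split {m} (x ∷ xs) ws m∉
  rewrite ≢⇒≡ᵇ-false (m∉ ∘ here ∘ sym) | decFirst-split xs ws (m∉ ∘ there) = refl

dOp-split : ∀ {m} ys zs → m ∉ zs → dOp m (ys ++ m ∷ zs) ≡ just (ys ++ lowered m ++ zs)
dOp-split {m} ys zs m∉zs = begin
  Maybe.map reverse (decFirst m (reverse (ys ++ m ∷ zs)))
    ≡⟨ cong (Maybe.map reverse ∘ decFirst m) (reverse-++₃ ys (m ∷ []) zs) ⟩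
  Maybe.map reverse (decFirst m (reverse zs ++ m ∷ reverse ys))
    ≡⟨ cong (Maybe.map reverse) (decFirst-split (reverse zs) (reverse ys) (m∉zs ∘ reverse⁻)) ⟩
  just (reverse (reverse zs ++ lowered m ++ reverse ys))
    ≡⟨ cong just (reverse-++₃ (reverse zs) (lowered m) (reverse ys)) ⟩
  just (reverse (reverse ys) ++ reverse (lowered m) ++ reverse (reverse zs))
    ≡⟨ cong (λ l → just (reverse (reverse ys) ++ l ++ reverse (reverse zs))) (reverse-lowered m) ⟩
  just (reverse (reverse ys) ++ lowered m ++ reverse (reverse zs))
    ≡⟨ cong₂ (λ a c → just (a ++ lowered m ++ c)) (reverse-involutive ys) (reverse-involutive zs) ⟩
  just (ys ++ lowered m ++ zs)
    ∎
  where open ≡-Reasoning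

rowLen-shape : ∀ τ k → rowLen τ (suc k) ≡ nth 0 (shape τ) k
rowLen-shape [] k = refl
rowLen-shape (x ∷ τ) zero = refl
rowLen-shape (x ∷ τ) (suc k) = rowLen-shape τ k

largestBelow-lastRow : ∀ {m} τ ys zs → shape τ ≡ ys ++ m ∷ zs → m ∉ zs →
  largestBelow (λ r → rowLen τ r ≡ᵇ m) (suc (length τ)) ≡ just (suc (length ys))
largestBelow-lastRow {m} τ ys zs split m∉zs =
  largestBelow-hit (length τ) hit miss (s≤s z≤n) (subst (length ys <_) length-split (length-middle ys m zs))
  where
  rowLen-split : ∀ k → rowLen τ (suc k) ≡ nth 0 (ys ++ m ∷ zs) k
  rowLen-split k = trans (rowLen-shape τ k) (cong (λ α → nth 0 α k) split)
  length-split : length (ys ++ m ∷ zs) ≡ length τ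
  length-split = trans (cong length (sym split)) (length-map length τ)
  hit : (rowLen τ (suc (length ys)) ≡ᵇ m) ≡ true
  hit = trans (cong (_≡ᵇ m) (trans (rowLen-split (length ys)) (nth-middle 0 ys m zs))) (≡ᵇ-refl m)
  miss : ∀ r → suc (length ys) < r → r < suc (length τ) → (rowLen τ r ≡ᵇ m) ≡ false
  miss (suc k) (s≤s ys<k) (s≤s k<τ) = ≢⇒≡ᵇ-false λ rowLen≡m →
    m∉zs (subst (_∈ zs) (trans (sym (rowLen-split k)) rowLen≡m)
                 (nth-after-middle 0 ys m zs k ys<k (subst (k <_) (sym length-split) k<τ)))

shape-setEntry : ∀ r c v τ → shape (setEntry r c v τ) ≡ shape τ
shape-setEntry r c v τ = trans (map-modifyNth length {h = λ n → n} (length-modifyNth _ (c ∸ 1)) (r ∸ 1) τ)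
                               (modifyNth-id (r ∸ 1) (shape τ))

shape-applyMoves : ∀ m ms τ → shape (applyMoves m ms τ) ≡ shape τ
shape-applyMoves m [] τ = refl
shape-applyMoves m ((r , v) ∷ ms) τ =
  trans (shape-applyMoves m ms (setEntry r m v τ)) (shape-setEntry r m v τ)

shape-deleteBox : ∀ {j} τ ys zs → shape τ ≡ ys ++ suc j ∷ zs →
  shape (deleteBox (suc (length ys)) (suc j) τ) ≡ ys ++ lowered (suc j) ++ zs
shape-deleteBox {zero} τ ys zs split = begin
  map length (deleteNth (length ys) τ)  ≡⟨ map-deleteNth length (length ys) τ ⟩
  deleteNth (length ys) (shape τ)       ≡⟨ cong (deleteNth (length ys)) split ⟩
  deleteNth (length ys) (ys ++ 1 ∷ zs)  ≡⟨ deleteNth-middle ys 1 zs ⟩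
  ys ++ zs                              ∎
  where open ≡-Reasoning
shape-deleteBox {suc k} τ ys zs split = begin
  map length (modifyNth (take m) (length ys) τ)   ≡⟨ map-modifyNth length (length-take m) (length ys) τ ⟩
  modifyNth (m ⊓_) (length ys) (shape τ)          ≡⟨ cong (modifyNth (m ⊓_) (length ys)) split ⟩
  modifyNth (m ⊓_) (length ys) (ys ++ suc m ∷ zs) ≡⟨ modifyNth-middle (m ⊓_) ys (suc m) zs ⟩
  ys ++ m ⊓ suc m ∷ zs                            ≡⟨ cong (λ v → ys ++ v ∷ zs) (m≤n⇒m⊓n≡m (n≤1+n m)) ⟩
  ys ++ m ∷ zs                                    ∎
  where
  m = suc k
  open ≡-Reasoning

phi-split : ∀ {j} τ ys zs → AddableInCol (rearrange (shape τ)) (suc (suc j)) →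
  shape τ ≡ ys ++ suc j ∷ zs → suc j ∉ zs →
  Σ Tableau λ σ → phi (suc j) τ ≡ just σ × shape σ ≡ ys ++ lowered (suc j) ++ zs
phi-split {j} τ ys zs addable split m∉zs with addableInCol? (rearrange (shape τ)) (suc (suc j))
... | no ¬addable = contradiction addable ¬addable
... | yes _ rewrite largestBelow-lastRow τ ys zs split m∉zs =
  _ , refl , shape-deleteBox _ ys zs (trans (shape-applyMoves m (moves τ m (chain τ m r₁ r₁)) τ) split)
  where
  m = suc j
  r₁ = suc (length ys)

phi-step : ∀ {j} τ → AddableInCol (rearrange (shape τ)) (suc (suc j)) →
  Σ Tableau λ σ → phi (suc j) τ ≡ just σ × dOp (suc j) (shape τ) ≡ just (shape σ)
                × AddableInCol (rearrange (shape σ)) (suc j)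
phi-step {j} τ addable
  with ys , zs , split , m∉zs ← lastSplit (shape τ) (addable⇒∈ (shape τ) addable)
  with σ , phi≡ , shape-σ ← phi-split τ ys zs addable split m∉zs
  = σ , phi≡ , trans (cong (dOp (suc j)) split) (trans (dOp-split ys zs m∉zs) (cong just (sym shape-σ)))
  , subst (λ α → AddableInCol (rearrange α) (suc j)) (sym shape-σ) (lowered-addable ys zs)

Phi-shape : ∀ i τ → AddableInCol (rearrange (shape τ)) (suc i) →
  Σ Tableau λ σ → Phi i τ ≡ just σ × vOp i (shape τ) ≡ just (shape σ)
Phi-shape zero τ _ = τ , refl , refl
Phi-shape (suc j) τ addable
  with σ , phi≡ , dOp≡ , addable′ ← phi-step τ addable
  with ρ , Phi≡ , vOp≡ ← Phi-shape j σ addable′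
  = ρ , trans (cong (_>>= Phi j) phi≡) Phi≡ , trans (cong (_>>= vOp j) dOp≡) vOp≡

corollary6p23 : (α : Composition) (τ : Tableau) (i : ℕ) →
    SSRCT τ → shape τ ≡ α → AddableInCol (rearrange α) (suc i) →
    Σ Tableau (λ σ → (Phi i τ ≡ just σ) × (vOp i α ≡ just (shape σ)))
corollary6p23 .(shape τ) τ i _ refl = Phi-shape i τ
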